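{- Let $T$ be a tree with threshold function $t$, let $k\ge1$ be the number of external influencers, and let $v$ be a leaf of $T$ with unique neighbour $w$. Let $T'=T-\{v\}$, with thresholds inherited from $T$. Let $T''$ be the same tree as $T'$ except that the threshold of $w$ is reduced by $1$. Then $T$ has a pervading link set if and only if one of the following holds: (a) $t(v)\le k$ and $T''$ has a pervading link set; (b) $t(v)=k+1$ and $T'$ has a pervading link set.
   Context: A network is a finite simple undirected graph $G=(V,E)$ with a threshold function $t:V\to\mathbb{Z}_{\ge 0}$. Let $U=\{\mu_1,\dots,\mu_k\}$ be a set of $k$ external influencers (not in $V$), which are active from the start. A link set is a set $S\subseteq\{(\mu,v):\mu\in U, v\in V\}$; for $v\in V$ let $s(v)\le k$ denote the number of links of $S$ incident to $v$. The diffusion process is defined as follows, where $\Gamma_G(v)$ is the neighbourhood of $v$. At step $0$ the active set is $A_0=\{v: s(v)\ge t(v)\}$. At step $j\ge1$ the active set is $A_j=A_{j-1}\cup\{v: |\Gamma_G(v)\cap A_{j-1}|\ge t(v)-s(v)\}$. Active nodes remain active. $S$ is a pervading link set if eventually all nodes are active. -}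

module Defs where

open import Data.Nat using (ℕ; zero; suc; _+_; _∸_; _≤ᵇ_)
open import Data.Bool using (Bool; true; false; _∧_; _∨_; if_then_else_)
open import Data.Fin using (Fin; zero; suc; inject₁; fromℕ; punchIn; _≟_)
open import Data.Product using (Σ; ∃; _×_; _,_)
open import Relation.Binary.PropositionalEquality using (_≡_)
open import Relation.Nullary using (¬_; does)
open import Function.Definitions using (Injective)

record Graph (n : ℕ) : Set where
  field
    adj    : Fin n → Fin n → Bool
    sym    : ∀ u v → adj u v ≡ adj v u
    irrefl : ∀ u → adj u u ≡ false
open Graph public

data Reach {n : ℕ} (G : Graph n) : Fin n → Fin n → Set where
  here : ∀ {u} → Reach G u u
  step : ∀ {u x v} → adj G u x ≡ true → Reach G x v → Reach G u v

Connected : ∀ {n} → Graph n → Set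
Connected {n} G = ∀ (u v : Fin n) → Reach G u v

record Cycle {n : ℕ} (G : Graph n) : Set where
  field
    len    : ℕ
    c      : Fin (suc (suc (suc len))) → Fin n
    inj    : Injective _≡_ _≡_ c
    edges  : ∀ (i : Fin (suc (suc len))) → adj G (c (inject₁ i)) (c (suc i)) ≡ true
    close  : adj G (c (fromℕ (suc (suc len)))) (c zero) ≡ true

Acyclic : ∀ {n} → Graph n → Set
Acyclic G = ¬ Cycle G

-- a tree: nonempty, connected, acyclic
IsTree : ∀ {n} → Graph n → Set
IsTree {n} G = Σ (Fin n) (λ _ → Connected G × Acyclic G)

count : ∀ {n} → (Fin n → Bool) → ℕ
count {zero}  p = 0
count {suc n} p = (if p zero then 1 else 0) + count (λ i → p (suc i))

-- link set between k influencers and the vertices: link μ v = true iff (μ, v) ∈ S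
LinkSet : ℕ → ℕ → Set
LinkSet k n = Fin k → Fin n → Bool

linksAt : ∀ {k n} → LinkSet k n → Fin n → ℕ
linksAt S v = count (λ μ → S μ v)

active : ∀ {k n} → Graph n → (Fin n → ℕ) → LinkSet k n → ℕ → Fin n → Bool
active G t S zero    v = t v ≤ᵇ linksAt S v
active G t S (suc j) v =
  active G t S j v ∨ ((t v ∸ linksAt S v) ≤ᵇ count (λ u → adj G v u ∧ active G t S j u))

Pervading : ∀ {k n} → Graph n → (Fin n → ℕ) → LinkSet k n → Set
Pervading {n = n} G t S = ∃ λ (j : ℕ) → ∀ (v : Fin n) → active G t S j v ≡ true

HasPervading : ∀ {n} → ℕ → Graph n → (Fin n → ℕ) → Set
HasPervading {n} k G t = ∃ λ (S : LinkSet k n) → Pervading G t S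

-- deleting vertex v from a graph on Fin (suc n); vertices of the result are relabelled via punchIn v
delete : ∀ {n} → Graph (suc n) → Fin (suc n) → Graph n
delete G v = record
  { adj    = λ i j → adj G (punchIn v i) (punchIn v j)
  ; sym    = λ i j → sym G (punchIn v i) (punchIn v j)
  ; irrefl = λ i → irrefl G (punchIn v i) }

lowerAt : ∀ {n} → (Fin n → ℕ) → Fin n → Fin n → ℕ
lowerAt t w i = if does (i ≟ w) then t i ∸ 1 else t i

module Submission where

-- The process depends on t and S only through the residual thresholds r = t ∸ s, so it
-- suffices to compare link-free processes.  As a leaf, v adds at most one active neighbour,
-- and only to w.  Hence dropping v and lowering the threshold of w by one never slows the
-- process down; if r v ≥ 1, v becomes active only after w, so dropping v alone does not
-- either; and if r v ≥ 2 (forced by t v ≥ k + 2), v is never activated.  Conversely, link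
-- v to every influencer, so that r v = t v ∸ k: if t v ≤ k, v is active from the start and
-- helps w exactly as the lowered threshold did, one step later; if t v = k + 1, v becomes
-- active one step after w.

open import Defs hiding (sym)
open import Data.Nat using (ℕ; zero; suc; _+_; _∸_; _≤_; _≤ᵇ_; z≤n; s≤s; s≤s⁻¹)
open import Data.Nat.Properties
  using (≤-trans; ≤-refl; ≤-reflexive; n≤1+n; ≤ᵇ⇒≤; ≤⇒≤ᵇ; <-cmp; 0∸n≡0; ∸-+-assoc; +-comm;
         m≤n+m; m≤n+m∸n; m∸n≤m; m≤n+o⇒m∸n≤o; m+n≤o⇒m≤o∸n; m≤n⇒m∸n≡0; ∸-monoˡ-≤;
         m+n∸n≡m; +-identityʳ; +-commutativeSemigroup; +-monoˡ-≤; +-monoʳ-≤)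
open import Algebra.Properties.CommutativeSemigroup +-commutativeSemigroup
  using (x∙yz≈y∙xz)
open import Data.Bool using (Bool; true; false; _∧_; _∨_; if_then_else_)
open import Data.Bool.Properties using (T-≡; ∨-zeroʳ)
open import Data.Fin using (Fin; zero; suc; punchIn; _≟_)
open import Data.Fin.Properties using (punchInᵢ≢i; punchIn-injective; punchIn-punchOut)
open import Data.Product using (_×_; _,_; ∃)
open import Data.Sum using (_⊎_; inj₁; inj₂)
open import Data.Empty using (⊥-elim)
open import Data.Vec.Functional using (insertAt; removeAt)
open import Data.Vec.Functional.Properties using (insertAt-lookup; insertAt-punchIn)
open import Function using (_∘_)
open import Function.Bundles using (_⇔_; mk⇔; Equivalence)
open import Relation.Binary.Definitions using (tri<; tri≈; tri>)
open import Relation.Binary.PropositionalEquality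
  using (_≡_; _≢_; refl; sym; trans; cong; cong₂; subst; module ≡-Reasoning)
open import Relation.Nullary using (¬_; yes; no; does; contradiction)

private
  variable
    k n : ℕ

≤ᵇ-true⇒≤ : ∀ {m n} → (m ≤ᵇ n) ≡ true → m ≤ n
≤ᵇ-true⇒≤ {m} {n} e = ≤ᵇ⇒≤ m n (Equivalence.from T-≡ e)

≤⇒≤ᵇ-true : ∀ {m n} → m ≤ n → (m ≤ᵇ n) ≡ true
≤⇒≤ᵇ-true m≤n = Equivalence.to T-≡ (≤⇒≤ᵇ m≤n)

≤ᵇ≡∸≤ᵇ0 : ∀ m n → (m ≤ᵇ n) ≡ (m ∸ n ≤ᵇ 0)
≤ᵇ≡∸≤ᵇ0 zero    n       = cong (_≤ᵇ 0) (sym (0∸n≡0 n))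
≤ᵇ≡∸≤ᵇ0 (suc m) zero    = refl
≤ᵇ≡∸≤ᵇ0 (suc m) (suc n) = trans (suc≤ᵇsuc m) (≤ᵇ≡∸≤ᵇ0 m n)
  where
  suc≤ᵇsuc : ∀ m → (suc m ≤ᵇ suc n) ≡ (m ≤ᵇ n)
  suc≤ᵇsuc zero    = refl
  suc≤ᵇsuc (suc m) = refl

∨-true : ∀ {x y} → (x ∨ y) ≡ true → x ≡ true ⊎ y ≡ true
∨-true {true}  _ = inj₁ refl
∨-true {false} e = inj₂ e

∧-trueˡ : ∀ {x y} → (x ∧ y) ≡ true → x ≡ true
∧-trueˡ {true} _ = refl

indicator : Bool → ℕ
indicator b = if b then 1 else 0

indicator≤1 : ∀ b → indicator b ≤ 1
indicator≤1 true  = ≤-refl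
indicator≤1 false = z≤n

indicator-pos : ∀ {b} → 1 ≤ indicator b → b ≡ true
indicator-pos {true} _ = refl

count-cong : {p q : Fin n → Bool} → (∀ x → p x ≡ q x) → count p ≡ count q
count-cong {zero}  e = refl
count-cong {suc n} e = cong₂ (λ b c → indicator b + c) (e zero) (count-cong (e ∘ suc))

count-≤ : (p : Fin n → Bool) → count p ≤ n
count-≤ {zero}  p = z≤n
count-≤ {suc n} p with p zero
... | true  = s≤s (count-≤ (p ∘ suc))
... | false = ≤-trans (count-≤ (p ∘ suc)) (n≤1+n n)

count-mono : (p q : Fin n → Bool) → (∀ x → p x ≡ true → q x ≡ true) → count p ≤ count q
count-mono {zero}  p q p⇒q = z≤n
count-mono {suc n} p q p⇒q with p zero in p₀ | q zero in q₀
... | true  | true  = s≤s (count-mono _ _ (p⇒q ∘ suc))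
... | true  | false = contradiction (trans (sym (p⇒q zero p₀)) q₀) λ ()
... | false | true  = ≤-trans (count-mono _ _ (p⇒q ∘ suc)) (n≤1+n _)
... | false | false = count-mono _ _ (p⇒q ∘ suc)

count-∧-mono : ∀ {p q q′ : Fin n → Bool} → (∀ x → q x ≡ true → q′ x ≡ true) →
               count (λ x → p x ∧ q x) ≤ count (λ x → p x ∧ q′ x)
count-∧-mono {p = p} q⇒q′ = count-mono _ _ λ x → ∧-mono (p x) (q⇒q′ x)
  where
  ∧-mono : ∀ a {b c} → (b ≡ true → c ≡ true) → (a ∧ b) ≡ true → (a ∧ c) ≡ true
  ∧-mono true b⇒c = b⇒c

count-all : count {n} (λ _ → true) ≡ n
count-all {zero}  = refl
count-all {suc n} = cong suc count-all

count-none : (p : Fin n → Bool) → (∀ x → p x ≡ false) → count p ≡ 0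
count-none {zero}  p none = refl
count-none {suc n} p none rewrite none zero = count-none (p ∘ suc) (none ∘ suc)

count-punchIn : (v : Fin (suc n)) (p : Fin (suc n) → Bool) →
                count p ≡ indicator (p v) + count (p ∘ punchIn v)
count-punchIn zero    p = refl
count-punchIn {suc n} (suc v) p = begin
  indicator (p zero) + count (p ∘ suc)
    ≡⟨ cong (indicator (p zero) +_) (count-punchIn v (p ∘ suc)) ⟩
  indicator (p zero) + (indicator (p (suc v)) + count (p ∘ suc ∘ punchIn v))
    ≡⟨ x∙yz≈y∙xz (indicator (p zero)) (indicator (p (suc v))) _ ⟩
  indicator (p (suc v)) + (indicator (p zero) + count (p ∘ suc ∘ punchIn v))
    ∎
  where open ≡-Reasoning

count-punchIn-≤ : (v : Fin (suc n)) (p : Fin (suc n) → Bool) → count (p ∘ punchIn v) ≤ count p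
count-punchIn-≤ v p = subst (count (p ∘ punchIn v) ≤_) (sym (count-punchIn v p)) (m≤n+m _ _)

count-single : (x : Fin (suc n)) (p : Fin (suc n) → Bool) → (∀ y → p y ≡ true → y ≡ x) →
               count p ≡ indicator (p x)
count-single x p only = begin
  count p                                    ≡⟨ count-punchIn x p ⟩
  indicator (p x) + count (p ∘ punchIn x)    ≡⟨ cong (indicator (p x) +_) (count-none _ elsewhere) ⟩
  indicator (p x) + 0                        ≡⟨ +-identityʳ _ ⟩
  indicator (p x)                            ∎
  where
  open ≡-Reasoning
  elsewhere : ∀ i → p (punchIn x i) ≡ false
  elsewhere i with p (punchIn x i) in pᵢ
  ... | true  = contradiction (only _ pᵢ) (punchInᵢ≢i x i)
  ... | false = refl

∀-punchIn : ∀ {P : Fin (suc n) → Set} (v : Fin (suc n)) →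
            P v → (∀ i → P (punchIn v i)) → ∀ u → P u
∀-punchIn {P = P} v Pv Pᵢ u with u ≟ v
... | yes refl = Pv
... | no  u≢v  = subst P (punchIn-punchOut (u≢v ∘ sym)) (Pᵢ _)

noLinks : LinkSet 0 n
noLinks ()

-- The process with residual thresholds r and no influencers.  It is opaque so that
-- activeʳ G r j u stays rigid and its arguments can be inferred by unification.
opaque
  activeʳ : Graph n → (Fin n → ℕ) → ℕ → Fin n → Bool
  activeʳ G r = active G r noLinks

activeNeighbours : Graph n → (Fin n → ℕ) → ℕ → Fin n → ℕ
activeNeighbours G r j u = count (λ x → adj G u x ∧ activeʳ G r j x)

Pervadingʳ : Graph n → (Fin n → ℕ) → Set
Pervadingʳ {n} G r = ∃ λ j → ∀ (u : Fin n) → activeʳ G r j u ≡ true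

module _ {G : Graph n} {r : Fin n → ℕ} where

  opaque
    unfolding activeʳ

    activeʳ-zero : ∀ {u} → r u ≤ 0 → activeʳ G r 0 u ≡ true
    activeʳ-zero = ≤⇒≤ᵇ-true

    activeʳ-zero⁻¹ : ∀ {u} → activeʳ G r 0 u ≡ true → r u ≤ 0
    activeʳ-zero⁻¹ = ≤ᵇ-true⇒≤

    activeʳ-stays : ∀ {j u} → activeʳ G r j u ≡ true → activeʳ G r (suc j) u ≡ true
    activeʳ-stays e rewrite e = refl

    activeʳ-fires : ∀ {j u} → r u ≤ activeNeighbours G r j u → activeʳ G r (suc j) u ≡ true
    activeʳ-fires {j} {u} bound =
      trans (cong (activeʳ G r j u ∨_) (≤⇒≤ᵇ-true bound)) (∨-zeroʳ _)

    activeʳ-step : ∀ {j u} → activeʳ G r (suc j) u ≡ true →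
                   activeʳ G r j u ≡ true ⊎ r u ≤ activeNeighbours G r j u
    activeʳ-step e with ∨-true e
    ... | inj₁ earlier = inj₁ earlier
    ... | inj₂ bound   = inj₂ (≤ᵇ-true⇒≤ bound)

  activeʳ-forever : ∀ {u} → activeʳ G r 0 u ≡ true → ∀ j → activeʳ G r j u ≡ true
  activeʳ-forever e zero    = e
  activeʳ-forever e (suc j) = activeʳ-stays (activeʳ-forever e j)

residual : (Fin n → ℕ) → LinkSet k n → Fin n → ℕ
residual t S u = t u ∸ linksAt S u

module _ {G : Graph n} {t : Fin n → ℕ} {S : LinkSet k n} {r : Fin n → ℕ}
         (residual≗r : ∀ u → residual t S u ≡ r u) where

  opaque
    unfolding activeʳ

    active≡activeʳ : ∀ j u → active G t S j u ≡ activeʳ G r j u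
    active≡activeʳ zero    u = trans (≤ᵇ≡∸≤ᵇ0 (t u) (linksAt S u)) (cong (_≤ᵇ 0) (residual≗r u))
    active≡activeʳ (suc j) u = cong₂ _∨_ (active≡activeʳ j u) (cong₂ _≤ᵇ_ (residual≗r u)
      (count-cong λ x → cong (adj G u x ∧_) (active≡activeʳ j x)))

  pervading⇔residual : Pervading G t S ⇔ Pervadingʳ G r
  pervading⇔residual = mk⇔
    (λ (j , all) → j , λ u → trans (sym (active≡activeʳ j u)) (all u))
    (λ (j , all) → j , λ u → trans (active≡activeʳ j u) (all u))

restrict : Fin (suc n) → LinkSet k (suc n) → LinkSet k n
restrict v S μ = removeAt (S μ) v

extend : Fin (suc n) → LinkSet k n → LinkSet k (suc n)
extend v S′ μ = insertAt (S′ μ) v true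

linksAt-≤ : (S : LinkSet k n) (u : Fin n) → linksAt S u ≤ k
linksAt-≤ S u = count-≤ _

linksAt-extend : (v : Fin (suc n)) (S′ : LinkSet k n) → linksAt (extend v S′) v ≡ k
linksAt-extend v S′ = trans (count-cong λ μ → insertAt-lookup (S′ μ) v true) count-all

linksAt-extend-punchIn : (v : Fin (suc n)) (S′ : LinkSet k n) (i : Fin n) →
                         linksAt (extend v S′) (punchIn v i) ≡ linksAt S′ i
linksAt-extend-punchIn v S′ i = count-cong λ μ → insertAt-punchIn (S′ μ) v true i

activeʳ-delete : (G : Graph (suc n)) (r : Fin (suc n) → ℕ) (v : Fin (suc n)) → ∀ j i →
                 activeʳ (delete G v) (r ∘ punchIn v) j i ≡ true →
                 activeʳ G r j (punchIn v i) ≡ true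
activeʳ-delete G r v zero    i e = activeʳ-zero (activeʳ-zero⁻¹ e)
activeʳ-delete G r v (suc j) i e with activeʳ-step e
... | inj₁ earlier = activeʳ-stays (activeʳ-delete G r v j i earlier)
... | inj₂ bound   = activeʳ-fires (≤-trans bound (≤-trans
  (count-∧-mono {p = adj (delete G v) i} (activeʳ-delete G r v j))
  (count-punchIn-≤ v (λ x → adj G (punchIn v i) x ∧ activeʳ G r j x))))

lowerAt-≤ : (f : Fin n → ℕ) (w i : Fin n) → lowerAt f w i ≤ f i
lowerAt-≤ f w i with i ≟ w
... | yes _ = m∸n≤m (f i) 1
... | no  _ = ≤-refl

lowerAt-∸ : ∀ (f m : Fin n → ℕ) {g w} → (∀ l → f l ∸ m l ≡ g l) →
            ∀ i → lowerAt f w i ∸ m i ≡ lowerAt g w i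
lowerAt-∸ f m {g} {w} e i with i ≟ w
... | no  _ = e i
... | yes _ = begin
  (f i ∸ 1) ∸ m i    ≡⟨ ∸-+-assoc (f i) 1 (m i) ⟩
  f i ∸ (1 + m i)    ≡⟨ cong (f i ∸_) (+-comm 1 (m i)) ⟩
  f i ∸ (m i + 1)    ≡⟨ sym (∸-+-assoc (f i) (m i) 1) ⟩
  (f i ∸ m i) ∸ 1    ≡⟨ cong (_∸ 1) (e i) ⟩
  g i ∸ 1            ∎
  where open ≡-Reasoning

lowerAt-bound : ∀ (f : Fin n → ℕ) w i x {c} →
                f i ≤ indicator (does (i ≟ w) ∧ x) + c → lowerAt f w i ≤ c
lowerAt-bound f w i x {c} bound with i ≟ w
... | yes _ = m≤n+o⇒m∸n≤o (f i) 1 (≤-trans bound (+-monoˡ-≤ c (indicator≤1 x)))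
... | no  _ = bound

lowerAt-bound⁻¹ : ∀ (f : Fin n → ℕ) w i {x c} → x ≡ true →
                  lowerAt f w i ≤ c → f i ≤ indicator (does (i ≟ w) ∧ x) + c
lowerAt-bound⁻¹ f w i refl bound with i ≟ w
... | yes _ = ≤-trans (m≤n+m∸n (f i) 1) (+-monoʳ-≤ 1 bound)
... | no  _ = bound

module Leaf (G : Graph (suc n)) (v : Fin (suc n)) (w : Fin n)
            (leaf : ∀ u → adj G v u ≡ true ⇔ u ≡ punchIn v w) where

  G′ : Graph n
  G′ = delete G v

  adj-punchIn-leaf : ∀ i → adj G (punchIn v i) v ≡ does (i ≟ w)
  adj-punchIn-leaf i with i ≟ w | adj G (punchIn v i) v in vᵢ
  ... | yes refl | false = trans (sym (trans (Graph.sym G v _) vᵢ)) (Equivalence.from (leaf _) refl)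
  ... | yes refl | true  = refl
  ... | no  i≢w  | true  = contradiction
          (punchIn-injective v i w (Equivalence.to (leaf _) (trans (Graph.sym G v _) vᵢ))) i≢w
  ... | no  i≢w  | false = refl

  module _ {r : Fin (suc n) → ℕ} where

    private
      r′ r″ : Fin n → ℕ
      r′ = r ∘ punchIn v
      r″ = lowerAt r′ w

      activeNeighbours-leaf : ∀ j → activeNeighbours G r j v ≡ indicator (activeʳ G r j (punchIn v w))
      activeNeighbours-leaf j = trans
        (count-single (punchIn v w) (λ x → adj G v x ∧ activeʳ G r j x)
                      λ x e → Equivalence.to (leaf x) (∧-trueˡ {y = activeʳ G r j x} e))
        (cong (λ b → indicator (b ∧ activeʳ G r j (punchIn v w))) (Equivalence.from (leaf _) refl))

      activeNeighbours-punchIn : ∀ j i →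
        activeNeighbours G r j (punchIn v i)
          ≡ indicator (does (i ≟ w) ∧ activeʳ G r j v)
            + count (λ l → adj G′ i l ∧ activeʳ G r j (punchIn v l))
      activeNeighbours-punchIn j i = trans
        (count-punchIn v (λ x → adj G (punchIn v i) x ∧ activeʳ G r j x))
        (cong (λ b → indicator (b ∧ activeʳ G r j v) + _) (adj-punchIn-leaf i))

    activeʳ-lowered : ∀ j i → activeʳ G r j (punchIn v i) ≡ true → activeʳ G′ r″ j i ≡ true
    activeʳ-lowered zero    i e = activeʳ-zero (≤-trans (lowerAt-≤ r′ w i) (activeʳ-zero⁻¹ e))
    activeʳ-lowered (suc j) i e with activeʳ-step e
    ... | inj₁ earlier = activeʳ-stays (activeʳ-lowered j i earlier)
    ... | inj₂ bound   = activeʳ-fires (≤-trans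
            (lowerAt-bound r′ w i _ (subst (r (punchIn v i) ≤_) (activeNeighbours-punchIn j i) bound))
            (count-∧-mono (activeʳ-lowered j)))

    activeʳ-lowered⁻¹ : r v ≡ 0 → ∀ j i →
                        activeʳ G′ r″ j i ≡ true → activeʳ G r (suc j) (punchIn v i) ≡ true
    activeʳ-lowered⁻¹ r₀ = go
      where
      fires : ∀ j i → r″ i ≤ count (λ l → adj G′ i l ∧ activeʳ G r j (punchIn v l)) →
              activeʳ G r (suc j) (punchIn v i) ≡ true
      fires j i bound = activeʳ-fires (subst (r (punchIn v i) ≤_)
        (sym (activeNeighbours-punchIn j i))
        (lowerAt-bound⁻¹ r′ w i (activeʳ-forever (activeʳ-zero (≤-reflexive r₀)) j) bound))

      go : ∀ j i → activeʳ G′ r″ j i ≡ true → activeʳ G r (suc j) (punchIn v i) ≡ true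
      go zero    i e = fires 0 i (≤-trans (activeʳ-zero⁻¹ e) z≤n)
      go (suc j) i e with activeʳ-step e
      ... | inj₁ earlier = activeʳ-stays (go j i earlier)
      ... | inj₂ bound   = fires (suc j) i (≤-trans bound (count-∧-mono (go j)))

    leaf-active⇒neighbour-active : 1 ≤ r v → ∀ j →
                                   activeʳ G r j v ≡ true → activeʳ G r j (punchIn v w) ≡ true
    leaf-active⇒neighbour-active pos zero    e = contradiction (≤-trans pos (activeʳ-zero⁻¹ e)) λ ()
    leaf-active⇒neighbour-active pos (suc j) e with activeʳ-step e
    ... | inj₁ earlier = activeʳ-stays (leaf-active⇒neighbour-active pos j earlier)
    ... | inj₂ bound   = activeʳ-stays (indicator-pos
            (≤-trans pos (subst (r v ≤_) (activeNeighbours-leaf j) bound)))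

    -- v only ever helps w when w is already active
    helped-by-leaf : 1 ≤ r v → ∀ j i {c} →
                     r (punchIn v i) ≤ indicator (does (i ≟ w) ∧ activeʳ G r j v) + c →
                     activeʳ G r j (punchIn v i) ≡ true ⊎ r (punchIn v i) ≤ c
    helped-by-leaf pos j i bound with i ≟ w | activeʳ G r j v in vActive
    ... | yes refl | true  = inj₁ (leaf-active⇒neighbour-active pos j vActive)
    ... | yes refl | false = inj₂ bound
    ... | no  _    | _     = inj₂ bound

    activeʳ-removed : 1 ≤ r v → ∀ j i → activeʳ G r j (punchIn v i) ≡ true → activeʳ G′ r′ j i ≡ true
    activeʳ-removed pos zero    i e = activeʳ-zero (activeʳ-zero⁻¹ e)
    activeʳ-removed pos (suc j) i e with activeʳ-step e
    ... | inj₁ earlier = activeʳ-stays (activeʳ-removed pos j i earlier)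
    ... | inj₂ bound
          with helped-by-leaf pos j i (subst (r (punchIn v i) ≤_) (activeNeighbours-punchIn j i) bound)
    ...   | inj₁ earlier = activeʳ-stays (activeʳ-removed pos j i earlier)
    ...   | inj₂ bound′  = activeʳ-fires (≤-trans bound′ (count-∧-mono (activeʳ-removed pos j)))

    leaf-never-active : 2 ≤ r v → ∀ j → activeʳ G r j v ≢ true
    leaf-never-active big zero    e = contradiction (≤-trans big (activeʳ-zero⁻¹ e)) λ ()
    leaf-never-active big (suc j) e with activeʳ-step e
    ... | inj₁ earlier = leaf-never-active big j earlier
    ... | inj₂ bound   = contradiction
            (≤-trans big (≤-trans (subst (r v ≤_) (activeNeighbours-leaf j) bound) (indicator≤1 _)))
            λ { (s≤s ()) }

    leaf-activated : r v ≤ 1 → ∀ {j} → activeʳ G r j (punchIn v w) ≡ true → activeʳ G r (suc j) v ≡ true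
    leaf-activated small {j} e =
      activeʳ-fires (subst (r v ≤_) (sym (trans (activeNeighbours-leaf j) (cong indicator e))) small)

  module _ {t : Fin (suc n) → ℕ} where

    pervading-lowered : ∀ {S : LinkSet k (suc n)} →
                        Pervading G t S → Pervading G′ (lowerAt (t ∘ punchIn v) w) (restrict v S)
    pervading-lowered {S = S} P with Equivalence.to (pervading⇔residual (λ _ → refl)) P
    ... | j , all =
      Equivalence.from (pervading⇔residual (lowerAt-∸ (t ∘ punchIn v) (linksAt (restrict v S)) λ _ → refl))
        (j , λ i → activeʳ-lowered j i (all (punchIn v i)))

    pervading-removed : ∀ {S : LinkSet k (suc n)} → suc k ≤ t v →
                        Pervading G t S → Pervading G′ (t ∘ punchIn v) (restrict v S)
    pervading-removed {S = S} tv P with Equivalence.to (pervading⇔residual (λ _ → refl)) P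
    ... | j , all = Equivalence.from (pervading⇔residual (λ _ → refl))
                      (j , λ i → activeʳ-removed pos j i (all (punchIn v i)))
      where
      pos : 1 ≤ residual t S v
      pos = m+n≤o⇒m≤o∸n 1 (≤-trans (s≤s (linksAt-≤ S v)) tv)

    ¬pervading : ∀ {S : LinkSet k (suc n)} → suc (suc k) ≤ t v → ¬ Pervading G t S
    ¬pervading {S = S} tv P with Equivalence.to (pervading⇔residual (λ _ → refl)) P
    ... | j , all = leaf-never-active big j (all v)
      where
      big : 2 ≤ residual t S v
      big = m+n≤o⇒m≤o∸n 2 (≤-trans (s≤s (s≤s (linksAt-≤ S v))) tv)

    module _ {S′ : LinkSet k n} where

      private
        S : LinkSet k (suc n)
        S = extend v S′

        residual-v : residual t S v ≡ t v ∸ k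
        residual-v = cong (t v ∸_) (linksAt-extend v S′)

        residual-punchIn : ∀ i → residual (t ∘ punchIn v) S′ i ≡ residual t S (punchIn v i)
        residual-punchIn i = cong (t (punchIn v i) ∸_) (sym (linksAt-extend-punchIn v S′ i))

      pervading-lowered⁻¹ : t v ≤ k → Pervading G′ (lowerAt (t ∘ punchIn v) w) S′ → Pervading G t S
      pervading-lowered⁻¹ tv P′
        with Equivalence.to (pervading⇔residual (lowerAt-∸ (t ∘ punchIn v) (linksAt S′) residual-punchIn)) P′
      ... | j , all = Equivalence.from (pervading⇔residual (λ _ → refl))
        (suc j , ∀-punchIn v (activeʳ-forever v₀ (suc j)) λ i → activeʳ-lowered⁻¹ r₀ j i (all i))
        where
        r₀ : residual t S v ≡ 0
        r₀ = trans residual-v (m≤n⇒m∸n≡0 tv)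
        v₀ : activeʳ G (residual t S) 0 v ≡ true
        v₀ = activeʳ-zero (≤-reflexive r₀)

      pervading-removed⁻¹ : t v ≤ suc k → Pervading G′ (t ∘ punchIn v) S′ → Pervading G t S
      pervading-removed⁻¹ tv P′ with Equivalence.to (pervading⇔residual residual-punchIn) P′
      ... | j , all = Equivalence.from (pervading⇔residual (λ _ → refl))
        (suc j , ∀-punchIn v (leaf-activated small (activeʳ-delete G _ v j w (all w)))
                             λ i → activeʳ-stays (activeʳ-delete G _ v j i (all i)))
        where
        small : residual t S v ≤ 1
        small = subst (_≤ 1) (sym residual-v) (≤-trans (∸-monoˡ-≤ k tv) (≤-reflexive (m+n∸n≡m 1 k)))

    hasPervading⇔lowered⊎removed : ∀ {k} →
      HasPervading k G t ⇔
        ((t v ≤ k × HasPervading k G′ (lowerAt (t ∘ punchIn v) w))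
         ⊎ (t v ≡ suc k × HasPervading k G′ (t ∘ punchIn v)))
    hasPervading⇔lowered⊎removed {k} = mk⇔ forward backward
      where
      forward : HasPervading k G t →
                (t v ≤ k × HasPervading k G′ (lowerAt (t ∘ punchIn v) w))
                ⊎ (t v ≡ suc k × HasPervading k G′ (t ∘ punchIn v))
      forward (S , P) with <-cmp (t v) (suc k)
      ... | tri< tv<1+k _ _ = inj₁ (s≤s⁻¹ tv<1+k , restrict v S , pervading-lowered P)
      ... | tri≈ _ tv≡1+k _ =
        inj₂ (tv≡1+k , restrict v S , pervading-removed (≤-reflexive (sym tv≡1+k)) P)
      ... | tri> _ _ tv>1+k = ⊥-elim (¬pervading tv>1+k P)

      backward : (t v ≤ k × HasPervading k G′ (lowerAt (t ∘ punchIn v) w))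
                 ⊎ (t v ≡ suc k × HasPervading k G′ (t ∘ punchIn v)) →
                 HasPervading k G t
      backward (inj₁ (tv≤k , S′ , P′))    = extend v S′ , pervading-lowered⁻¹ tv≤k P′
      backward (inj₂ (tv≡1+k , S′ , P′)) = extend v S′ , pervading-removed⁻¹ (≤-reflexive tv≡1+k) P′

mainTheorem2 : ∀ {n : ℕ} (T : Graph (suc n)) (t : Fin (suc n) → ℕ) (k : ℕ) →
    1 ≤ k → IsTree T →
    (v : Fin (suc n)) (w : Fin n) →
    (∀ u → adj T v u ≡ true ⇔ u ≡ punchIn v w) →
    HasPervading k T t ⇔
      ((t v ≤ k × HasPervading k (delete T v) (lowerAt (t ∘ punchIn v) w))
       ⊎ (t v ≡ suc k × HasPervading k (delete T v) (t ∘ punchIn v)))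
mainTheorem2 T t k _ _ v w leaf = Leaf.hasPervading⇔lowered⊎removed T v w leaf
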